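{- For all $n\ge 1$, $\left|\mathrm{Av}_{n+2}[\overline{132},\overline{213},\overline{321}]\right|=\left|\mathcal{R}_n\right|$.
   Context: For $\sigma\in S_m$, the cyclic permutation $[\sigma]$ is the set of all rotations of $\sigma$; $[S_m]$ is the set of cyclic permutations of length $m$. $[\sigma]$ contains the totally vincular cyclic pattern $[\overline{abc}]$ if some three cyclically consecutive entries $\sigma_i\sigma_{i+1}\sigma_{i+2}$ (indices mod $m$) are order-isomorphic to $abc$. $\mathrm{Av}_{m}[\overline{132},\overline{213},\overline{321}]$ is the set of cyclic permutations in $[S_m]$ avoiding all three of $[\overline{132}],[\overline{213}],[\overline{321}]$. A partial cyclic order on a set $X$ is a ternary relation $Z\subseteq X^3$ such that for all $x,y,z,u\in X$: (cyclicity) $(x,y,z)\in Z\Rightarrow(y,z,x)\in Z$; (antisymmetry) $(x,y,z)\in Z\Rightarrow(z,y,x)\notin Z$; (transitivity) $(x,y,z)\in Z$ and $(x,z,u)\in Z\Rightarrow(x,y,u)\in Z$. It is a total cyclic order if for every triple $(x,y,z)$ of distinct elements, $(x,y,z)\in Z$ or $(z,y,x)\in Z$. $\mathcal{R}_n$ is the set of total cyclic orders $Z$ on $[n+2]$ such that $(i,i+1,i+2)\in Z$ for all $1\le i\le n$, and $(n+1,n+2,1)\in Z$ and $(n+2,1,2)\in Z$. -}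

module Defs where

open import Data.Nat as ℕ using (ℕ; zero; suc; _+_)
open import Data.Nat.DivMod using (_%_; m%n<n)
open import Data.Fin as Fin using (Fin; toℕ; fromℕ<; fromℕ; inject₁; _<_)
open import Data.Fin.Permutation using (Permutation′; _⟨$⟩ʳ_)
open import Data.Bool using (Bool; true; false)
open import Data.Product using (Σ; ∃; ∃-syntax; _×_; _,_; proj₁)
open import Data.Sum using (_⊎_)
open import Relation.Nullary using (¬_)
open import Relation.Binary.PropositionalEquality using (_≡_)

next : ∀ {k} → Fin (suc k) → Fin (suc k)
next {k} i = fromℕ< (m%n<n (suc (toℕ i)) (suc k))

rot : ∀ {k} → ℕ → Fin (suc k) → Fin (suc k)
rot zero    i = i
rot (suc r) i = next (rot r i)

-- Permutations σ ∈ S_m, σ_i = σ ⟨$⟩ʳ i (positions and values 0-based)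

-- τ is a rotation of σ:  τ_i = σ_{i+r} (indices mod m) for some r.
-- [σ] = [τ]  iff  IsRotation σ τ.
IsRotation : ∀ {k} → Permutation′ (suc k) → Permutation′ (suc k) → Set
IsRotation σ τ = ∃[ r ] (∀ i → τ ⟨$⟩ʳ i ≡ σ ⟨$⟩ʳ rot r i)

module _ {k : ℕ} (σ : Permutation′ (suc k)) (i : Fin (suc k)) where
  private
    a = σ ⟨$⟩ʳ i
    b = σ ⟨$⟩ʳ next i
    c = σ ⟨$⟩ʳ next (next i)

  Occ132 : Set
  Occ132 = (a < c) × (c < b)

  Occ213 : Set
  Occ213 = (b < a) × (a < c)

  Occ321 : Set
  Occ321 = (c < b) × (b < a)

Contains132 Contains213 Contains321 : ∀ {k} → Permutation′ (suc k) → Set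
Contains132 σ = ∃[ i ] Occ132 σ i
Contains213 σ = ∃[ i ] Occ213 σ i
Contains321 σ = ∃[ i ] Occ321 σ i

-- [σ] avoids [132‾], [213‾], [321‾]
-- (this property is invariant under rotation, so it is a property of [σ])
Avoids : ∀ {k} → Permutation′ (suc k) → Set
Avoids σ = ¬ Contains132 σ × ¬ Contains213 σ × ¬ Contains321 σ

-- representatives of Av_m[132‾,213‾,321‾] (m = suc k); the set itself is
-- the quotient of this type by IsRotation (on the first component)
AvRep : ℕ → Set
AvRep k = Σ (Permutation′ (suc k)) Avoids

TernRel : ℕ → Set
TernRel m = Fin m → Fin m → Fin m → Bool

_≈ᵀ_ : ∀ {m} → TernRel m → TernRel m → Set
Z ≈ᵀ W = ∀ x y z → Z x y z ≡ W x y z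

module _ {m : ℕ} (Z : TernRel m) where

  IsPartialCyclicOrder : Set
  IsPartialCyclicOrder =
    (∀ x y z → Z x y z ≡ true → Z y z x ≡ true)
    × (∀ x y z → Z x y z ≡ true → ¬ (Z z y x ≡ true))
    × (∀ x y z u → Z x y z ≡ true → Z x z u ≡ true → Z x y u ≡ true)

  IsTotalCyclicOrder : Set
  IsTotalCyclicOrder =
    IsPartialCyclicOrder
    × (∀ x y z → ¬ x ≡ y → ¬ y ≡ z → ¬ x ≡ z → (Z x y z ≡ true) ⊎ (Z z y x ≡ true))

-- 𝓡_n : total cyclic orders Z on [n+2] (element j ∈ [n+2] is the Fin index j-1) with
--   (i, i+1, i+2) ∈ Z for 1 ≤ i ≤ n,  (n+1, n+2, 1) ∈ Z,  (n+2, 1, 2) ∈ Z.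
InR : (n : ℕ) → TernRel (suc (suc n)) → Set
InR n Z =
  IsTotalCyclicOrder Z
  × (∀ (i j l : Fin (suc (suc n))) → toℕ j ≡ suc (toℕ i) → toℕ l ≡ suc (toℕ j)
       → Z i j l ≡ true)
  × (Z (inject₁ (fromℕ n)) (fromℕ (suc n)) Fin.zero ≡ true)
  × (Z (fromℕ (suc n)) Fin.zero (Fin.suc Fin.zero) ≡ true)

RElem : ℕ → Set
RElem n = Σ (TernRel (suc (suc n))) (InR n)

-- Equal cardinality of Av_{n+2}[…] (= AvRep (suc n) / IsRotation) and 𝓡_n
-- (= RElem n / ≈ᵀ): a map of representatives inducing a bijection of classes.

record ClassBijection (n : ℕ) : Set where
  field
    f          : AvRep (suc n) → RElem n
    respects   : ∀ (σ τ : AvRep (suc n)) → IsRotation (proj₁ σ) (proj₁ τ)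
                   → proj₁ (f σ) ≈ᵀ proj₁ (f τ)
    injective  : ∀ (σ τ : AvRep (suc n)) → proj₁ (f σ) ≈ᵀ proj₁ (f τ)
                   → IsRotation (proj₁ σ) (proj₁ τ)
    surjective : ∀ (Z : RElem n) → ∃[ σ ] (proj₁ (f σ) ≈ᵀ proj₁ Z)

{-# OPTIONS --safe #-}

-- A window σᵢ σᵢ₊₁ σᵢ₊₂ = (a, b, c) is an occurrence of 321, 213 or 132 exactly when (c, b, a) is
-- cyclically increasing.  The entries of a window are distinct (m ≥ 3), so [σ] avoids the three
-- patterns iff every window is cyclically increasing, i.e. iff the cyclic order induced on
-- positions by the values of σ contains every (i, i+1, i+2).  Rotating σ so that its value 0
-- comes first makes this cyclic order an invariant of [σ].  Conversely, cutting a total cyclic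
-- order on positions at 0 yields a linear order whose rank function is a bijection fixing 0 that
-- induces it; and two bijections fixing 0 that induce the same cyclic order are order-isomorphic,
-- hence equal.

module Submission where

open import Defs
open import Data.Nat using (ℕ; _≤_)

open import Data.Bool using (true)
import Data.Bool as Bool
open import Data.Bool.Properties using (⇔→≡)
open import Data.Empty using (⊥-elim)
open import Data.Fin using (Fin; zero; suc; toℕ; fromℕ<; fromℕ; inject₁; punchOut)
open import Data.Fin.Permutation using (Permutation′; _⟨$⟩ʳ_; _⟨$⟩ˡ_; inverseˡ; inverseʳ; permutation)
open import Data.Fin.Properties
  using ( toℕ-fromℕ<; toℕ-fromℕ; toℕ-inject₁; toℕ-injective; toℕ<n; <-strictTotalOrder
        ; <-irrefl; <-asym; ≤-antisym; _≟_; any?; punchOut-injective; injective⇒≤ )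
open import Data.Fin.Subset using (Subset; _∈_; _⊂_; ∣_∣)
open import Data.Fin.Subset.Properties using (p⊂q⇒∣p∣<∣q∣; ∣⊤∣≡n; ∈⊤; ⊆⊤; ∣⊥∣≡0; Empty-unique)
import Data.Nat as ℕ
open import Data.Nat using (zero; suc; _+_; _∸_; s≤s)
import Data.Nat.Properties as ℕ
open import Data.Nat.DivMod using (_%_; m<n⇒m%n≡m; n%n≡0)
open import Data.Product using (∃-syntax; _×_; _,_; proj₁; proj₂)
open import Data.Sum using (_⊎_; inj₁; inj₂; [_,_])
import Data.Sum as Sum
open import Data.Vec using (tabulate; lookup)
open import Data.Vec.Properties using (lookup∘tabulate; []=⇒lookup; lookup⇒[]=)
open import Function using (_∘_; mk⇔)
open import Function.Bundles using (module Injection)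
open import Function.Properties.Inverse using (↔⇒↣)
open import Function.Definitions using (Injective)
open import Relation.Binary using (Rel; StrictTotalOrder; tri<; tri≈; tri>)
open import Relation.Binary.PropositionalEquality
  using (_≡_; _≢_; _≗_; refl; sym; trans; cong; subst; subst₂; ≢-sym; module ≡-Reasoning)
open import Relation.Nullary using (¬_; Dec; yes; no; does)
open import Relation.Nullary.Decidable using (dec-true; _×-dec_; _⊎-dec_; ¬?)

witness : ∀ {p} {P : Set p} (d : Dec P) → does d ≡ true → P
witness (yes p) _ = p

module _ {a ℓ} {A : Set a} (_≺_ : Rel A ℓ) where

  Cyc : A → A → A → Set ℓ
  Cyc x y z = (x ≺ y × y ≺ z) ⊎ (y ≺ z × z ≺ x) ⊎ (z ≺ x × x ≺ y)

  Cyc-rotate : ∀ {x y z} → Cyc x y z → Cyc y z x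
  Cyc-rotate (inj₁ p)        = inj₂ (inj₂ p)
  Cyc-rotate (inj₂ (inj₁ p)) = inj₁ p
  Cyc-rotate (inj₂ (inj₂ p)) = inj₂ (inj₁ p)

  Cyc-bottom : ∀ {x y z} → (∀ w → ¬ w ≺ x) → Cyc x y z → y ≺ z
  Cyc-bottom _  (inj₁ (_ , y≺z))        = y≺z
  Cyc-bottom ⊥x (inj₂ (inj₁ (_ , z≺x))) = ⊥-elim (⊥x _ z≺x)
  Cyc-bottom ⊥x (inj₂ (inj₂ (z≺x , _))) = ⊥-elim (⊥x _ z≺x)

Cyc-mono : ∀ {a ℓ₁ ℓ₂} {A : Set a} {_≺₁_ : Rel A ℓ₁} {_≺₂_ : Rel A ℓ₂} →
           (∀ {x y} → x ≺₁ y → x ≺₂ y) → ∀ {x y z} → Cyc _≺₁_ x y z → Cyc _≺₂_ x y z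
Cyc-mono f (inj₁ (p , q))        = inj₁ (f p , f q)
Cyc-mono f (inj₂ (inj₁ (p , q))) = inj₂ (inj₁ (f p , f q))
Cyc-mono f (inj₂ (inj₂ (p , q))) = inj₂ (inj₂ (f p , f q))

module CyclicOrderOf {a ℓ₁ ℓ₂} (O : StrictTotalOrder a ℓ₁ ℓ₂) where
  open StrictTotalOrder O using (_≈_; _<_; compare; _<?_; asym) renaming (trans to <-trans)

  Cyc-antisym : ∀ {x y z} → Cyc _<_ x y z → ¬ Cyc _<_ z y x
  Cyc-antisym (inj₁ (p , q))        (inj₁ (r , s))        = asym q r
  Cyc-antisym (inj₁ (p , q))        (inj₂ (inj₁ (r , s))) = asym p r
  Cyc-antisym (inj₁ (p , q))        (inj₂ (inj₂ (r , s))) = asym q s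
  Cyc-antisym (inj₂ (inj₁ (p , q))) (inj₁ (r , s))        = asym p r
  Cyc-antisym (inj₂ (inj₁ (p , q))) (inj₂ (inj₁ (r , s))) = asym q s
  Cyc-antisym (inj₂ (inj₁ (p , q))) (inj₂ (inj₂ (r , s))) = asym p s
  Cyc-antisym (inj₂ (inj₂ (p , q))) (inj₁ (r , s))        = asym q s
  Cyc-antisym (inj₂ (inj₂ (p , q))) (inj₂ (inj₁ (r , s))) = asym q r
  Cyc-antisym (inj₂ (inj₂ (p , q))) (inj₂ (inj₂ (r , s))) = asym p r

  Cyc-trans : ∀ {x y z u} → Cyc _<_ x y z → Cyc _<_ x z u → Cyc _<_ x y u
  Cyc-trans (inj₁ (p , q))        (inj₁ (r , s))        = inj₁ (p , <-trans q s)
  Cyc-trans (inj₁ (p , q))        (inj₂ (inj₁ (r , s))) = ⊥-elim (asym (<-trans (<-trans p q) r) s)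
  Cyc-trans (inj₁ (p , q))        (inj₂ (inj₂ (r , s))) = inj₂ (inj₂ (r , p))
  Cyc-trans (inj₂ (inj₁ (p , q))) (inj₁ (r , s))        = ⊥-elim (asym q r)
  Cyc-trans (inj₂ (inj₁ (p , q))) (inj₂ (inj₁ (r , s))) = inj₂ (inj₁ (<-trans p r , s))
  Cyc-trans (inj₂ (inj₁ (p , q))) (inj₂ (inj₂ (r , s))) = ⊥-elim (asym q s)
  Cyc-trans (inj₂ (inj₂ (p , q))) (inj₁ (r , s))        = ⊥-elim (asym p r)
  Cyc-trans (inj₂ (inj₂ (p , q))) (inj₂ (inj₁ (r , s))) = inj₂ (inj₂ (s , q))
  Cyc-trans (inj₂ (inj₂ (p , q))) (inj₂ (inj₂ (r , s))) = ⊥-elim (asym p s)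

  Cyc-total : ∀ {x y z} → ¬ x ≈ y → ¬ y ≈ z → ¬ x ≈ z → Cyc _<_ x y z ⊎ Cyc _<_ z y x
  Cyc-total {x} {y} {z} x≉y y≉z x≉z with compare x y | compare y z | compare x z
  ... | tri≈ _ x≈y _ | _            | _            = ⊥-elim (x≉y x≈y)
  ... | _            | tri≈ _ y≈z _ | _            = ⊥-elim (y≉z y≈z)
  ... | _            | _            | tri≈ _ x≈z _ = ⊥-elim (x≉z x≈z)
  ... | tri< p _ _   | tri< q _ _   | _            = inj₁ (inj₁ (p , q))
  ... | tri< p _ _   | tri> _ _ q   | tri< r _ _   = inj₂ (inj₂ (inj₂ (r , q)))
  ... | tri< p _ _   | tri> _ _ q   | tri> _ _ r   = inj₁ (inj₂ (inj₂ (r , p)))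
  ... | tri> _ _ p   | tri< q _ _   | tri< r _ _   = inj₂ (inj₂ (inj₁ (p , r)))
  ... | tri> _ _ p   | tri< q _ _   | tri> _ _ r   = inj₁ (inj₂ (inj₁ (q , r)))
  ... | tri> _ _ p   | tri> _ _ q   | _            = inj₂ (inj₁ (q , p))

  cyc? : ∀ x y z → Dec (Cyc _<_ x y z)
  cyc? x y z = (x <? y ×-dec y <? z) ⊎-dec (y <? z ×-dec z <? x) ⊎-dec (z <? x ×-dec x <? y)

open Data.Fin using (_<_)

open module FinCyclicOrder {m : ℕ} = CyclicOrderOf (<-strictTotalOrder m)

opaque
  cycOn : ∀ {m n} → (Fin m → Fin n) → TernRel m
  cycOn f x y z = does (cyc? (f x) (f y) (f z))

  cycOn⁺ : ∀ {m n} {f : Fin m → Fin n} {x y z} → Cyc _<_ (f x) (f y) (f z) → cycOn f x y z ≡ true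
  cycOn⁺ {f = f} {x} {y} {z} = dec-true (cyc? (f x) (f y) (f z))

  cycOn⁻ : ∀ {m n} {f : Fin m → Fin n} {x y z} → cycOn f x y z ≡ true → Cyc _<_ (f x) (f y) (f z)
  cycOn⁻ {f = f} {x} {y} {z} = witness (cyc? (f x) (f y) (f z))

  cycOn-cong : ∀ {m n} {f g : Fin m → Fin n} → f ≗ g → cycOn f ≈ᵀ cycOn g
  cycOn-cong f≗g x y z rewrite f≗g x | f≗g y | f≗g z = refl

cycOn-isTotalCyclicOrder : ∀ {m n} {f : Fin m → Fin n} → Injective _≡_ _≡_ f →
                           IsTotalCyclicOrder (cycOn f)
cycOn-isTotalCyclicOrder f-inj =
  ( (λ _ _ _ → cycOn⁺ ∘ Cyc-rotate _<_ ∘ cycOn⁻)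
  , (λ _ _ _ c c′ → Cyc-antisym (cycOn⁻ c) (cycOn⁻ c′))
  , (λ _ _ _ _ c c′ → cycOn⁺ (Cyc-trans (cycOn⁻ c) (cycOn⁻ c′))) )
  , λ _ _ _ x≢y y≢z x≢z →
      Sum.map cycOn⁺ cycOn⁺ (Cyc-total (x≢y ∘ f-inj) (y≢z ∘ f-inj) (x≢z ∘ f-inj))

module _ {k : ℕ} where

  toℕ-next : (i : Fin (suc k)) → suc (toℕ i) ℕ.< suc k → toℕ (next i) ≡ suc (toℕ i)
  toℕ-next i lt = trans (toℕ-fromℕ< _) (m<n⇒m%n≡m lt)

  toℕ-next-wrap : (i : Fin (suc k)) → suc (toℕ i) ≡ suc k → toℕ (next i) ≡ 0
  toℕ-next-wrap i eq = trans (toℕ-fromℕ< _) (trans (cong (_% suc k) eq) (n%n≡0 (suc k)))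

  next-of-toℕ : ∀ {i j : Fin (suc k)} → toℕ j ≡ suc (toℕ i) → next i ≡ j
  next-of-toℕ {i} {j} eq =
    toℕ-injective (trans (toℕ-next i (subst (ℕ._< suc k) eq (toℕ<n j))) (sym eq))

  next-last : next (fromℕ k) ≡ zero
  next-last = toℕ-injective (toℕ-next-wrap (fromℕ k) (cong suc (toℕ-fromℕ k)))

  rot-+ : ∀ r s (i : Fin (suc k)) → rot r (rot s i) ≡ rot (r + s) i
  rot-+ zero    s i = refl
  rot-+ (suc r) s i = cong next (rot-+ r s i)

  rot-comm : ∀ r s (i : Fin (suc k)) → rot r (rot s i) ≡ rot s (rot r i)
  rot-comm r s i = begin
    rot r (rot s i)  ≡⟨ rot-+ r s i ⟩
    rot (r + s) i    ≡⟨ cong (λ t → rot t i) (ℕ.+-comm r s) ⟩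
    rot (s + r) i    ≡⟨ sym (rot-+ s r i) ⟩
    rot s (rot r i)  ∎
    where open ≡-Reasoning

  rot-next : ∀ r (i : Fin (suc k)) → rot r (next i) ≡ next (rot r i)
  rot-next r = rot-comm r 1

  toℕ-rot-zero : ∀ r → r ℕ.< suc k → toℕ (rot {k} r zero) ≡ r
  toℕ-rot-zero zero    _  = refl
  toℕ-rot-zero (suc r) lt = trans (toℕ-next _ (subst (ℕ._< suc k) (cong suc (sym ih)) lt)) (cong suc ih)
    where
    ih : toℕ (rot r zero) ≡ r
    ih = toℕ-rot-zero r (ℕ.<⇒≤ lt)

  rot-toℕ : (x : Fin (suc k)) → rot (toℕ x) zero ≡ x
  rot-toℕ x = toℕ-injective (toℕ-rot-zero (toℕ x) (toℕ<n x))

  rot-via-zero : ∀ r (x : Fin (suc k)) → rot r x ≡ rot (toℕ x) (rot r zero)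
  rot-via-zero r x = trans (cong (rot r) (sym (rot-toℕ x))) (rot-comm r (toℕ x) zero)

  rot-agree : ∀ r s → rot {k} r zero ≡ rot s zero → ∀ x → rot r x ≡ rot s x
  rot-agree r s eq x =
    trans (rot-via-zero r x) (trans (cong (rot (toℕ x)) eq) (sym (rot-via-zero s x)))

  rot-period : ∀ (x : Fin (suc k)) → rot (suc k) x ≡ x
  rot-period =
    rot-agree (suc k) 0 (toℕ-injective (toℕ-next-wrap _ (cong suc (toℕ-rot-zero k (ℕ.n<1+n k)))))

  rot-∸-cancel : ∀ {r} → r ℕ.≤ suc k → (x : Fin (suc k)) → rot (suc k ∸ r) (rot r x) ≡ x
  rot-∸-cancel {r} r≤ x =
    trans (rot-+ (suc k ∸ r) r x) (trans (cong (λ t → rot t x) (ℕ.m∸n+n≡m r≤)) (rot-period x))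

  rot-injective : ∀ {r} → r ℕ.≤ suc k → Injective _≡_ _≡_ (rot {k} r)
  rot-injective {r} r≤ {x} {y} eq =
    trans (sym (rot-∸-cancel r≤ x)) (trans (cong (rot (suc k ∸ r)) eq) (rot-∸-cancel r≤ y))

  rot-fixedPointFree : ∀ {r} → 0 ℕ.< r → r ℕ.< suc k → (x : Fin (suc k)) → rot r x ≢ x
  rot-fixedPointFree {r} 0<r r<m x eq =
    ℕ.<⇒≢ 0<r (sym (trans (sym (toℕ-rot-zero r r<m)) (cong toℕ r·0≡0)))
    where
    r·0≡0 : rot r zero ≡ zero
    r·0≡0 = rot-injective (ℕ.<⇒≤ (toℕ<n x))
              (trans (sym (rot-via-zero r x)) (trans eq (sym (rot-toℕ x))))

  next-≢ : 1 ≤ k → (i : Fin (suc k)) → i ≢ next i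
  next-≢ 1≤k i = ≢-sym (rot-fixedPointFree (s≤s ℕ.z≤n) (s≤s 1≤k) i)

  next²-≢ : 2 ≤ k → (i : Fin (suc k)) → i ≢ next (next i)
  next²-≢ 2≤k i = ≢-sym (rot-fixedPointFree (s≤s ℕ.z≤n) (s≤s 2≤k) i)

CyclicWindows : ∀ {k n} → (Fin (suc k) → Fin n) → Set
CyclicWindows f = ∀ i → Cyc _<_ (f i) (f (next i)) (f (next (next i)))

CyclicWindows-rot : ∀ {k n} {f : Fin (suc k) → Fin n} r → CyclicWindows f → CyclicWindows (f ∘ rot r)
CyclicWindows-rot r w i rewrite rot-next r (next i) | rot-next r i = w (rot r i)

⟨$⟩ʳ-injective : ∀ {m} (σ : Permutation′ m) → Injective _≡_ _≡_ (σ ⟨$⟩ʳ_)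
⟨$⟩ʳ-injective σ = Injection.injective (↔⇒↣ σ)

module _ {k : ℕ} (σ : Permutation′ (suc k)) where

  private
    σ-injective = ⟨$⟩ʳ-injective σ

  Avoids⇒CyclicWindows : 2 ≤ k → Avoids σ → CyclicWindows (σ ⟨$⟩ʳ_)
  Avoids⇒CyclicWindows 2≤k (¬132 , ¬213 , ¬321) i
    with Cyc-total (next-≢ (ℕ.<⇒≤ 2≤k) i ∘ σ-injective) (next-≢ (ℕ.<⇒≤ 2≤k) (next i) ∘ σ-injective)
                   (next²-≢ 2≤k i ∘ σ-injective)
  ... | inj₁ increasing           = increasing
  ... | inj₂ (inj₁ occ321)        = ⊥-elim (¬321 (i , occ321))
  ... | inj₂ (inj₂ (inj₁ occ213)) = ⊥-elim (¬213 (i , occ213))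
  ... | inj₂ (inj₂ (inj₂ occ132)) = ⊥-elim (¬132 (i , occ132))

  CyclicWindows⇒Avoids : CyclicWindows (σ ⟨$⟩ʳ_) → Avoids σ
  CyclicWindows⇒Avoids w =
      (λ (i , occ132) → Cyc-antisym (w i) (inj₂ (inj₂ occ132)))
    , (λ (i , occ213) → Cyc-antisym (w i) (inj₂ (inj₁ occ213)))
    , (λ (i , occ321) → Cyc-antisym (w i) (inj₁ occ321))

injective⇒surjective : ∀ {m} {f : Fin m → Fin m} → Injective _≡_ _≡_ f → ∀ v → ∃[ x ] f x ≡ v
injective⇒surjective {suc m} {f} f-inj v with any? (λ x → f x ≟ v)
... | yes hit  = hit
... | no  miss = ⊥-elim (ℕ.1+n≰n (injective⇒≤ {f = λ x → punchOut (v≢f x)}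
                                     (f-inj ∘ punchOut-injective (v≢f _) (v≢f _))))
  where
  v≢f : ∀ x → v ≢ f x
  v≢f x v≡fx = miss (x , sym v≡fx)

injective⇒permutation : ∀ {m} (f : Fin m → Fin m) → Injective _≡_ _≡_ f → Permutation′ m
injective⇒permutation f f-inj =
  permutation f (proj₁ ∘ surj) (λ v → proj₂ (surj v)) (λ x → f-inj (proj₂ (surj (f x))))
  where
  surj = injective⇒surjective f-inj

strictMono⇒≤ : ∀ {m} {g h : Fin m → Fin m} → (∀ v → ∃[ x ] g x ≡ v) →
               (∀ {x y} → g x < g y → h x < h y) → ∀ x → toℕ (g x) ℕ.≤ toℕ (h x)
strictMono⇒≤ {m} {g} {h} g-surj mono x = go (toℕ (g x)) x refl
  where
  go : ∀ j x → toℕ (g x) ≡ j → j ℕ.≤ toℕ (h x)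
  go zero    _ _       = ℕ.z≤n
  go (suc j) x gx≡1+j = ℕ.≤-trans (s≤s (go j x′ gx′≡j)) (mono gx′<gx)
    where
    j<m : j ℕ.< m
    j<m = ℕ.<⇒≤ (subst (ℕ._< m) gx≡1+j (toℕ<n (g x)))
    x′ = proj₁ (g-surj (fromℕ< j<m))
    gx′≡j : toℕ (g x′) ≡ j
    gx′≡j = trans (cong toℕ (proj₂ (g-surj (fromℕ< j<m)))) (toℕ-fromℕ< j<m)
    gx′<gx : g x′ < g x
    gx′<gx = subst₂ ℕ._<_ (sym gx′≡j) (sym gx≡1+j) (ℕ.n<1+n j)

strictMono-unique : ∀ {m} {g h : Fin m → Fin m} → Injective _≡_ _≡_ g →
                    Injective _≡_ _≡_ h → (∀ {x y} → g x < g y → h x < h y) →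
                    (∀ {x y} → h x < h y → g x < g y) → g ≗ h
strictMono-unique g-inj h-inj g⇒h h⇒g x =
  ≤-antisym (strictMono⇒≤ (injective⇒surjective g-inj) g⇒h x)
            (strictMono⇒≤ (injective⇒surjective h-inj) h⇒g x)

positive-image : ∀ {m} {h : Fin (suc m) → Fin (suc m)} → Injective _≡_ _≡_ h → h zero ≡ zero →
                 ∀ {x : Fin (suc m)} → x ≢ zero → 0 ℕ.< toℕ (h x)
positive-image {h = h} h-inj h0 {x} x≢0 =
  ℕ.n≢0⇒n>0 {toℕ (h x)} (λ hx≡0 → x≢0 (h-inj (trans (toℕ-injective hx≡0) (sym h0))))

cycOn-transfer : ∀ {m} {g h : Fin (suc m) → Fin (suc m)} →
                 Injective _≡_ _≡_ g → Injective _≡_ _≡_ h → g zero ≡ zero → h zero ≡ zero →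
                 cycOn g ≈ᵀ cycOn h → ∀ {x y} → g x < g y → h x < h y
cycOn-transfer {g = g} {h} g-inj h-inj g0 h0 eq {x} {y} gx<gy with x ≟ zero
... | yes refl = subst (_< h y) (sym h0) (positive-image h-inj h0 λ { refl → <-irrefl refl gx<gy })
... | no  x≢0  = Cyc-bottom _<_ (λ _ ()) (subst (λ w → Cyc _<_ w (h x) (h y)) h0 hCyc)
  where
  gCyc : Cyc _<_ (g zero) (g x) (g y)
  gCyc = inj₁ (subst (_< g x) (sym g0) (positive-image g-inj g0 x≢0) , gx<gy)
  hCyc : Cyc _<_ (h zero) (h x) (h y)
  hCyc = cycOn⁻ (trans (sym (eq zero x y)) (cycOn⁺ gCyc))

cycOn-injective : ∀ {m} {g h : Fin (suc m) → Fin (suc m)} →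
                  Injective _≡_ _≡_ g → Injective _≡_ _≡_ h → g zero ≡ zero → h zero ≡ zero →
                  cycOn g ≈ᵀ cycOn h → g ≗ h
cycOn-injective g-inj h-inj g0 h0 eq =
  strictMono-unique g-inj h-inj (cycOn-transfer g-inj h-inj g0 h0 eq)
                    (cycOn-transfer h-inj g-inj h0 g0 (λ x y z → sym (eq x y z)))

module CutAtZero {k : ℕ} {Z : TernRel (suc k)} (tco : IsTotalCyclicOrder Z) where

  private
    F = Fin (suc k)

    cyclic : ∀ {x y z} → Z x y z ≡ true → Z y z x ≡ true
    cyclic = proj₁ (proj₁ tco) _ _ _

    antisym : ∀ {x y z} → Z x y z ≡ true → Z z y x ≢ true
    antisym = proj₁ (proj₂ (proj₁ tco)) _ _ _

    transitive : ∀ {x y z u} → Z x y z ≡ true → Z x z u ≡ true → Z x y u ≡ true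
    transitive = proj₂ (proj₂ (proj₁ tco)) _ _ _ _

    total : ∀ {x y z} → x ≢ y → y ≢ z → x ≢ z → Z x y z ≡ true ⊎ Z z y x ≡ true
    total = proj₂ tco _ _ _

  distinct₁₃ : ∀ {x y z} → Z x y z ≡ true → x ≢ z
  distinct₁₃ c refl = antisym c c

  distinct₁₂ : ∀ {x y z} → Z x y z ≡ true → x ≢ y
  distinct₁₂ c refl = distinct₁₃ (cyclic c) refl

  distinct₂₃ : ∀ {x y z} → Z x y z ≡ true → y ≢ z
  distinct₂₃ c refl = distinct₁₃ (cyclic (cyclic c)) refl

  infix 4 _≺_ _≺?_

  _≺_ : F → F → Set
  y ≺ x = (y ≡ zero × x ≢ zero) ⊎ Z zero y x ≡ true

  _≺?_ : ∀ y x → Dec (y ≺ x)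
  y ≺? x = (y ≟ zero ×-dec ¬? (x ≟ zero)) ⊎-dec (Z zero y x Bool.≟ true)

  ≺-irrefl : ∀ {x} → ¬ x ≺ x
  ≺-irrefl (inj₁ (x≡0 , x≢0)) = x≢0 x≡0
  ≺-irrefl (inj₂ c)           = distinct₂₃ c refl

  ≺-zero : ∀ {x} → ¬ x ≺ zero
  ≺-zero (inj₁ (_ , 0≢0)) = 0≢0 refl
  ≺-zero (inj₂ c)         = distinct₁₃ c refl

  ≺-trans : ∀ {x y z} → x ≺ y → y ≺ z → x ≺ z
  ≺-trans (inj₁ (_ , y≢0)) (inj₁ (y≡0 , _))  = ⊥-elim (y≢0 y≡0)
  ≺-trans (inj₁ (x≡0 , _)) (inj₂ c)          = inj₁ (x≡0 , distinct₁₃ c ∘ sym)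
  ≺-trans (inj₂ c)         (inj₁ (refl , _)) = ⊥-elim (distinct₁₃ c refl)
  ≺-trans (inj₂ c)         (inj₂ c′)         = inj₂ (transitive c c′)

  ≺-total : ∀ {x y} → x ≢ y → x ≺ y ⊎ y ≺ x
  ≺-total {x} {y} x≢y with x ≟ zero | y ≟ zero
  ... | yes refl | yes refl = ⊥-elim (x≢y refl)
  ... | yes refl | no y≢0   = inj₁ (inj₁ (refl , y≢0))
  ... | no x≢0   | yes refl = inj₂ (inj₁ (refl , x≢0))
  ... | no x≢0   | no y≢0   =
    Sum.map inj₂ (inj₂ ∘ cyclic ∘ cyclic) (total (x≢0 ∘ sym) x≢y (y≢0 ∘ sym))

  ≺⇒Z : ∀ {x y z} → x ≺ y → y ≺ z → Z x y z ≡ true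
  ≺⇒Z (inj₁ (_ , y≢0))  (inj₁ (y≡0 , _))  = ⊥-elim (y≢0 y≡0)
  ≺⇒Z (inj₁ (refl , _)) (inj₂ c)          = c
  ≺⇒Z (inj₂ c)          (inj₁ (refl , _)) = ⊥-elim (distinct₁₃ c refl)
  ≺⇒Z (inj₂ c)          (inj₂ c′)
    with total (distinct₂₃ c) (distinct₂₃ c′) (distinct₂₃ (transitive c c′))
  ... | inj₁ zxyz = zxyz
  ... | inj₂ zzyx = ⊥-elim (antisym c (transitive (cyclic zzyx) (cyclic c′)))

  Cyc≺⇒Z : ∀ {x y z} → Cyc _≺_ x y z → Z x y z ≡ true
  Cyc≺⇒Z (inj₁ (x≺y , y≺z))        = ≺⇒Z x≺y y≺z
  Cyc≺⇒Z (inj₂ (inj₁ (y≺z , z≺x))) = cyclic (cyclic (≺⇒Z y≺z z≺x))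
  Cyc≺⇒Z (inj₂ (inj₂ (z≺x , x≺y))) = cyclic (≺⇒Z z≺x x≺y)

  below : F → Subset (suc k)
  below x = tabulate (λ y → does (y ≺? x))

  lookup-below : ∀ x y → lookup (below x) y ≡ does (y ≺? x)
  lookup-below x = lookup∘tabulate (λ y → does (y ≺? x))

  ∈-below⁺ : ∀ {x y} → y ≺ x → y ∈ below x
  ∈-below⁺ {x} {y} y≺x = lookup⇒[]= y (below x) (trans (lookup-below x y) (dec-true (y ≺? x) y≺x))

  ∈-below⁻ : ∀ {x y} → y ∈ below x → y ≺ x
  ∈-below⁻ {x} {y} y∈ = witness (y ≺? x) (trans (sym (lookup-below x y)) ([]=⇒lookup y∈))

  below-⊂ : ∀ {x y} → y ≺ x → below y ⊂ below x
  below-⊂ {y = y} y≺x =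
    (λ w∈ → ∈-below⁺ (≺-trans (∈-below⁻ w∈) y≺x)) , y , ∈-below⁺ y≺x , ≺-irrefl ∘ ∈-below⁻

  ∣below∣<∣⊤∣ : ∀ x → ∣ below x ∣ ℕ.< suc k
  ∣below∣<∣⊤∣ x =
    subst (∣ below x ∣ ℕ.<_) (∣⊤∣≡n (suc k)) (p⊂q⇒∣p∣<∣q∣ (⊆⊤ , x , ∈⊤ , ≺-irrefl ∘ ∈-below⁻))

  rank : F → F
  rank x = fromℕ< (∣below∣<∣⊤∣ x)

  toℕ-rank : ∀ x → toℕ (rank x) ≡ ∣ below x ∣
  toℕ-rank x = toℕ-fromℕ< (∣below∣<∣⊤∣ x)

  rank-zero : rank zero ≡ zero
  rank-zero = toℕ-injective (trans (toℕ-rank zero) (trans (cong ∣_∣ below-zero) (∣⊥∣≡0 (suc k))))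
    where
    below-zero = Empty-unique (λ (y , y∈) → ≺-zero (∈-below⁻ y∈))

  rank-mono : ∀ {x y} → y ≺ x → rank y < rank x
  rank-mono {x} {y} y≺x =
    subst₂ ℕ._<_ (sym (toℕ-rank y)) (sym (toℕ-rank x)) (p⊂q⇒∣p∣<∣q∣ (below-⊂ y≺x))

  rank-reflect : ∀ {x y} → rank y < rank x → y ≺ x
  rank-reflect {x} {y} ry<rx with y ≟ x
  ... | yes refl = ⊥-elim (<-irrefl refl ry<rx)
  ... | no  y≢x  = Sum.fromInj₁ (λ x≺y → ⊥-elim (<-asym ry<rx (rank-mono x≺y))) (≺-total y≢x)

  rank-injective : Injective _≡_ _≡_ rank
  rank-injective {x} {y} rx≡ry with x ≟ y
  ... | yes x≡y = x≡y
  ... | no  x≢y = ⊥-elim ([ (λ x≺y → <-irrefl rx≡ry (rank-mono x≺y))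
                          , (λ y≺x → <-irrefl (sym rx≡ry) (rank-mono y≺x)) ] (≺-total x≢y))

  Z≈cycOn-rank : Z ≈ᵀ cycOn rank
  Z≈cycOn-rank x y z = ⇔→≡ (mk⇔ (cycOn⁺ ∘ Z⇒Cyc) (Cyc⇒Z ∘ cycOn⁻))
    where
    Cyc⇒Z : ∀ {x y z} → Cyc _<_ (rank x) (rank y) (rank z) → Z x y z ≡ true
    Cyc⇒Z = Cyc≺⇒Z ∘ Cyc-mono {_≺₁_ = λ u v → rank u < rank v} (λ {u} {v} → rank-reflect {v} {u})
    Z⇒Cyc : Z x y z ≡ true → Cyc _<_ (rank x) (rank y) (rank z)
    Z⇒Cyc c with Cyc-total (distinct₁₂ c ∘ rank-injective) (distinct₂₃ c ∘ rank-injective)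
                           (distinct₁₃ c ∘ rank-injective)
    ... | inj₁ increasing = increasing
    ... | inj₂ decreasing = ⊥-elim (antisym c (Cyc⇒Z decreasing))

module _ {k : ℕ} where

  origin : Permutation′ (suc k) → Fin (suc k)
  origin σ = σ ⟨$⟩ˡ zero

  normalise : Permutation′ (suc k) → Fin (suc k) → Fin (suc k)
  normalise σ x = σ ⟨$⟩ʳ rot (toℕ (origin σ)) x

  normalise-injective : (σ : Permutation′ (suc k)) → Injective _≡_ _≡_ (normalise σ)
  normalise-injective σ = rot-injective (ℕ.<⇒≤ (toℕ<n (origin σ))) ∘ ⟨$⟩ʳ-injective σ

  normalise-zero : (σ : Permutation′ (suc k)) → normalise σ zero ≡ zero
  normalise-zero σ = trans (cong (σ ⟨$⟩ʳ_) (rot-toℕ (origin σ))) (inverseʳ σ)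

  normalise-fixesZero : (σ : Permutation′ (suc k)) → σ ⟨$⟩ʳ zero ≡ zero → normalise σ ≗ σ ⟨$⟩ʳ_
  normalise-fixesZero σ σ0≡0 x =
    cong (λ p → σ ⟨$⟩ʳ rot (toℕ p) x) (trans (cong (σ ⟨$⟩ˡ_) (sym σ0≡0)) (inverseˡ σ))

  normalise-rotation : (σ τ : Permutation′ (suc k)) → IsRotation σ τ → normalise σ ≗ normalise τ
  normalise-rotation σ τ (r , τ≡σ∘rot) x = sym (begin
    τ ⟨$⟩ʳ rot q x          ≡⟨ τ≡σ∘rot _ ⟩
    σ ⟨$⟩ʳ rot r (rot q x)  ≡⟨ cong (σ ⟨$⟩ʳ_) (rot-+ r q x) ⟩
    σ ⟨$⟩ʳ rot (r + q) x    ≡⟨ cong (σ ⟨$⟩ʳ_) (rot-agree (r + q) p r+q≡p x) ⟩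
    σ ⟨$⟩ʳ rot p x          ∎)
    where
    open ≡-Reasoning
    p = toℕ (origin σ)
    q = toℕ (origin τ)
    r·originτ≡originσ : rot r (origin τ) ≡ origin σ
    r·originτ≡originσ =
      ⟨$⟩ʳ-injective σ (trans (sym (τ≡σ∘rot _)) (trans (inverseʳ τ) (sym (inverseʳ σ))))
    r+q≡p : rot (r + q) zero ≡ rot p zero
    r+q≡p = begin
      rot (r + q) zero    ≡⟨ sym (rot-+ r q zero) ⟩
      rot r (rot q zero)  ≡⟨ cong (rot r) (rot-toℕ (origin τ)) ⟩
      rot r (origin τ)    ≡⟨ r·originτ≡originσ ⟩
      origin σ            ≡⟨ sym (rot-toℕ (origin σ)) ⟩
      rot p zero          ∎

  normalise⇒rotation : (σ τ : Permutation′ (suc k)) → normalise σ ≗ normalise τ → IsRotation σ τ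
  normalise⇒rotation σ τ eq = p + (suc k ∸ q) , λ i → begin
    τ ⟨$⟩ʳ i                                   ≡⟨ cong (τ ⟨$⟩ʳ_) (sym (unrotate i)) ⟩
    normalise τ (rot (suc k ∸ q) i)            ≡⟨ sym (eq _) ⟩
    normalise σ (rot (suc k ∸ q) i)            ≡⟨ cong (σ ⟨$⟩ʳ_) (rot-+ p (suc k ∸ q) i) ⟩
    σ ⟨$⟩ʳ rot (p + (suc k ∸ q)) i             ∎
    where
    open ≡-Reasoning
    p = toℕ (origin σ)
    q = toℕ (origin τ)
    unrotate : ∀ i → rot q (rot (suc k ∸ q) i) ≡ i
    unrotate i = trans (rot-comm q (suc k ∸ q) i) (rot-∸-cancel (ℕ.<⇒≤ (toℕ<n (origin τ))) i)

ContainsWindows : ∀ {k} → TernRel (suc k) → Set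
ContainsWindows Z = ∀ i → Z i (next i) (next (next i)) ≡ true

module _ {n : ℕ} {Z : TernRel (suc (suc n))} where

  private
    penultimate last : Fin (suc (suc n))
    penultimate = inject₁ (fromℕ n)
    last        = fromℕ (suc n)

    toℕ-penultimate : toℕ penultimate ≡ n
    toℕ-penultimate = trans (toℕ-inject₁ (fromℕ n)) (toℕ-fromℕ n)

    next-penultimate : next penultimate ≡ last
    next-penultimate = next-of-toℕ (trans (toℕ-fromℕ (suc n)) (cong suc (sym toℕ-penultimate)))

    next-zero : next zero ≡ suc {suc n} zero
    next-zero = next-of-toℕ refl

  InR⁺ : IsTotalCyclicOrder Z → ContainsWindows Z → InR n Z
  InR⁺ tco windows =
      tco
    , (λ i j l j≡1+i l≡1+j → window (next-of-toℕ j≡1+i) (next-of-toℕ l≡1+j))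
    , window next-penultimate next-last
    , window next-last next-zero
    where
    window : ∀ {i j l} → next i ≡ j → next j ≡ l → Z i j l ≡ true
    window {i} refl refl = windows i

  InR⇒ContainsWindows : InR n Z → ContainsWindows Z
  InR⇒ContainsWindows (_ , inner , aroundLast , aroundZero) i with ℕ.<-cmp (toℕ i) n
  ... | tri< i<n _ _ = inner i (next i) (next (next i)) i+1 i+2
    where
    i+1 : toℕ (next i) ≡ suc (toℕ i)
    i+1 = toℕ-next i (s≤s (ℕ.m≤n⇒m≤1+n i<n))
    i+2 : toℕ (next (next i)) ≡ suc (toℕ (next i))
    i+2 = toℕ-next (next i) (subst (λ t → suc t ℕ.< suc (suc n)) (sym i+1) (s≤s (s≤s i<n)))
  ... | tri≈ _ i≡n _
    with refl ← toℕ-injective {i = i} {penultimate} (trans i≡n (sym toℕ-penultimate))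
    rewrite next-penultimate | next-last {suc n} = aroundLast
  ... | tri> _ _ n<i
    with refl ← toℕ-injective {i = i} {last}
                  (trans (ℕ.≤-antisym (ℕ.s≤s⁻¹ (toℕ<n i)) n<i) (sym (toℕ-fromℕ (suc n))))
    rewrite next-last {suc n} | next-zero = aroundZero

module _ {n : ℕ} (1≤n : 1 ≤ n) where

  cyclicOrderOf : AvRep (suc n) → RElem n
  cyclicOrderOf (σ , avoids) =
      cycOn (normalise σ)
    , InR⁺ (cycOn-isTotalCyclicOrder (normalise-injective σ))
           (cycOn⁺ ∘ CyclicWindows-rot (toℕ (origin σ)) (Avoids⇒CyclicWindows σ (s≤s 1≤n) avoids))

  cyclicOrderOf-surjective : ∀ (Z : RElem n) → ∃[ σ ] (proj₁ (cyclicOrderOf σ) ≈ᵀ proj₁ Z)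
  cyclicOrderOf-surjective (Z , inR) = (σ , CyclicWindows⇒Avoids σ σ-windows) , cycOn-σ≈Z
    where
    open CutAtZero (proj₁ inR) using (rank; rank-injective; rank-zero; Z≈cycOn-rank)
    σ = injective⇒permutation rank rank-injective
    σ-windows : CyclicWindows (σ ⟨$⟩ʳ_)
    σ-windows i = cycOn⁻ (trans (sym (Z≈cycOn-rank _ _ _)) (InR⇒ContainsWindows inR i))
    cycOn-σ≈Z : cycOn (normalise σ) ≈ᵀ Z
    cycOn-σ≈Z x y z =
      trans (cycOn-cong (normalise-fixesZero σ rank-zero) x y z) (sym (Z≈cycOn-rank x y z))

theorem4p6 : ∀ (n : ℕ) → 1 ≤ n → ClassBijection n
theorem4p6 n 1≤n = record
  { f          = cyclicOrderOf 1≤n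
  ; respects   = λ (σ , _) (τ , _) → cycOn-cong ∘ normalise-rotation σ τ
  ; injective  = λ (σ , _) (τ , _) → normalise⇒rotation σ τ
                   ∘ cycOn-injective (normalise-injective σ) (normalise-injective τ)
                                     (normalise-zero σ) (normalise-zero τ)
  ; surjective = cyclicOrderOf-surjective 1≤n
  }
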